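{- Let $\mathcal S\subseteq 2^X$ be a pointed even set family. Then after a finite number of d-shiftings, $\mathcal S$ is transformed into a bouquet of halved cubes.
   Context: $X$ is a finite set. A set family is even if all its sets have even cardinality and pointed if it contains $\varnothing$. For a 2-set $\{e_i,e_j\}\subseteq X$, the d-shifting $\varphi_{ij}$ of a pointed even family $\mathcal S$ replaces every $S\in\mathcal S$ with $\{e_i,e_j\}\subseteq S$ and $S\setminus\{e_i,e_j\}\notin\mathcal S$ by $S\setminus\{e_i,e_j\}$, leaving all other sets unchanged; the result is the family $\varphi_{ij}(\mathcal S)$. A bouquet of halved cubes is an even set family $\mathcal B\subseteq 2^X$ such that for every $S\in\mathcal B$, every subset of $S$ of even cardinality belongs to $\mathcal B$. -}

module Defs where

open import Data.Bool using (Bool; true; false; _∧_; _∨_; not; if_then_else_)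
open import Data.Nat using (ℕ)
open import Data.Nat.Divisibility using (_∣_)
open import Data.Fin using (Fin)
open import Data.Fin.Subset using (Subset; ⊥; ⁅_⁆; _∪_; _─_; _⊆_; ∣_∣)
open import Data.Vec using (lookup)
open import Data.List using (List; foldl)
open import Data.Product using (Σ; _×_; _,_)
open import Relation.Binary.PropositionalEquality using (_≡_; _≢_)

-- The ground set X is Fin n; a subset of X is a 'Subset n' (a Bool vector).
-- A set family 𝒮 ⊆ 2^X is given by its (Boolean) characteristic function.
Family : ℕ → Set
Family n = Subset n → Bool

_∈F_ : ∀ {n} → Subset n → Family n → Set
S ∈F 𝒮 = 𝒮 S ≡ true

IsEven : ℕ → Set
IsEven k = 2 ∣ k

EvenFamily : ∀ {n} → Family n → Set
EvenFamily {n} 𝒮 = (S : Subset n) → S ∈F 𝒮 → IsEven ∣ S ∣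

Pointed : ∀ {n} → Family n → Set
Pointed 𝒮 = ⊥ ∈F 𝒮

pair : ∀ {n} → Fin n → Fin n → Subset n
pair i j = ⁅ i ⁆ ∪ ⁅ j ⁆

-- A set T belongs to φ_ij(𝒮) iff
--  * {e_i,e_j} ⊆ T : T ∈ 𝒮 and T ∖ {e_i,e_j} ∈ 𝒮 (otherwise T was replaced);
--  * e_i,e_j ∉ T   : T ∈ 𝒮, or T = S ∖ {e_i,e_j} for the replaced set
--                    S = T ∪ {e_i,e_j} ∈ 𝒮 (replaced exactly when T ∉ 𝒮);
--  * otherwise     : T ∈ 𝒮 (such sets are untouched).
dshift : ∀ {n} → Fin n → Fin n → Family n → Family n
dshift i j 𝒮 T with lookup T i | lookup T j
... | true  | true  = 𝒮 T ∧ 𝒮 (T ─ pair i j)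
... | false | false = 𝒮 T ∨ 𝒮 (T ∪ pair i j)
... | true  | false = 𝒮 T
... | false | true  = 𝒮 T

TwoSet : ℕ → Set
TwoSet n = Σ (Fin n) λ i → Σ (Fin n) λ j → i ≢ j

dshifts : ∀ {n} → List (TwoSet n) → Family n → Family n
dshifts ps 𝒮 = foldl (λ 𝒯 p → step p 𝒯) 𝒮 ps
  where
  step : _ → Family _ → Family _
  step (i , j , _) 𝒯 = dshift i j 𝒯

BouquetOfHalvedCubes : ∀ {n} → Family n → Set
BouquetOfHalvedCubes {n} ℬ =
  EvenFamily ℬ ×
  ((S T : Subset n) → S ∈F ℬ → T ⊆ S → IsEven ∣ T ∣ → T ∈F ℬ)

module Submission where

-- Order the subsets of X = Fin n lexicographically, a set
-- containing the first element preceding one that does not, and order the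
-- families lexicographically along this enumeration of subsets (a family
-- containing an earlier set being larger).  A d-shifting φ_ij only loses sets
-- S ⊇ {e_i,e_j} and gains their halves S ∖ {e_i,e_j}, each of which comes after
-- the lost S; hence φ_ij(𝒮) either equals 𝒮 or is strictly smaller.  The order
-- on families is well founded, so repeatedly applying some non-trivial
-- d-shifting terminates in a family fixed by every φ_ij.  Such a family is
-- closed under deleting a pair from a member, and an even family with this
-- property contains every even subset of its members: it is a bouquet of
-- halved cubes.

open import Defs
open import Data.Bool using (true; false; _∧_; _∨_)
open import Data.Bool.Properties using (∨-identityʳ)
open import Data.Nat using (ℕ; zero; suc; _*_; _+_)
open import Data.Nat.Base using (parity)
open import Data.Nat.Divisibility using (_∣_; divides; ∣m+n∣m⇒∣n; ∣-refl)
open import Data.Parity.Base using (0ℙ; _⁻¹)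
open import Data.Parity.Properties using (suc-homo-⁻¹; p≢p⁻¹)
open import Data.Fin using (Fin; zero; suc)
open import Data.Fin.Properties using (_≟_; suc-injective)
open import Data.Fin.Subset
  using (Subset; inside; outside; ⁅_⁆; _∪_; _─_; _∈_; _∉_; _⊆_; ∣_∣)
open import Data.Fin.Subset.Properties
  using (drop-there; drop-∷-⊆; x∈⁅x⁆; x∈⁅y⁆⇒x≡y; x≢y⇒x∉⁅y⁆; x∈p∪q⁺; x∈p∪q⁻;
         x∈p∧x∉q⇒x∈p─q; p─⊥≡p; p─q─r≡p─q∪r; ∪-identityˡ)
open import Data.Vec using ([]; _∷_; lookup; here; there)
open import Data.Vec.Properties using ([]=⇒lookup)
open import Data.List using (List; []; _∷_)
open import Data.Product using (Σ; ∃; _×_; _,_)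
open import Data.Product.Relation.Binary.Lex.Strict using (×-Lex; ×-wellFounded')
open import Data.Sum using (_⊎_; inj₁; inj₂)
open import Function.Base using (_on_; _∘_)
open import Induction.WellFounded using (WellFounded; Acc; acc)
import Relation.Binary.Construct.On as On
open import Relation.Binary.PropositionalEquality
  using (_≡_; _≢_; refl; sym; trans; cong; cong₂; subst; module ≡-Reasoning)
open import Relation.Nullary using (yes; no; contradiction)

open ≡-Reasoning

private
  variable
    n : ℕ

lookup-false⇒∉ : ∀ {p : Subset n} {x} → lookup p x ≡ false → x ∉ p
lookup-false⇒∉ px≡false x∈p = contradiction (trans (sym px≡false) ([]=⇒lookup x∈p)) λ ()

∣p∣≡1+∣p─⁅x⁆∣ : ∀ {p : Subset n} {x} → x ∈ p → ∣ p ∣ ≡ suc ∣ p ─ ⁅ x ⁆ ∣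
∣p∣≡1+∣p─⁅x⁆∣ {p = inside ∷ p} here = cong suc (cong ∣_∣ (sym (p─⊥≡p p)))
∣p∣≡1+∣p─⁅x⁆∣ {p = inside ∷ p} (there x∈p) = cong suc (∣p∣≡1+∣p─⁅x⁆∣ x∈p)
∣p∣≡1+∣p─⁅x⁆∣ {p = outside ∷ p} (there x∈p) = ∣p∣≡1+∣p─⁅x⁆∣ x∈p

∣p∣≡2+∣p─pair∣ : ∀ {p : Subset n} {i j} → i ≢ j → i ∈ p → j ∈ p →
                 ∣ p ∣ ≡ 2 + ∣ p ─ pair i j ∣
∣p∣≡2+∣p─pair∣ {p = p} {i} {j} i≢j i∈p j∈p = begin
  ∣ p ∣                    ≡⟨ ∣p∣≡1+∣p─⁅x⁆∣ i∈p ⟩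
  suc ∣ p ─ ⁅ i ⁆ ∣         ≡⟨ cong suc (∣p∣≡1+∣p─⁅x⁆∣ j∈p─i) ⟩
  2 + ∣ p ─ ⁅ i ⁆ ─ ⁅ j ⁆ ∣  ≡⟨ cong (λ q → 2 + ∣ q ∣) (p─q─r≡p─q∪r p ⁅ i ⁆ ⁅ j ⁆) ⟩
  2 + ∣ p ─ pair i j ∣      ∎
  where j∈p─i = x∈p∧x∉q⇒x∈p─q j∈p (x≢y⇒x∉⁅y⁆ (i≢j ∘ sym))

∪─-cancel : ∀ (p q : Subset n) → (∀ {x} → x ∈ q → x ∉ p) → (p ∪ q) ─ q ≡ p
∪─-cancel []      []            _        = refl
∪─-cancel (s ∷ p) (outside ∷ q) disjoint =
  cong₂ _∷_ (∨-identityʳ s) (∪─-cancel p q λ x∈q → disjoint (there x∈q) ∘ there)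
∪─-cancel (outside ∷ p) (inside ∷ q) disjoint =
  cong (outside ∷_) (∪─-cancel p q λ x∈q → disjoint (there x∈q) ∘ there)
∪─-cancel (inside ∷ p) (inside ∷ q) disjoint = contradiction here (disjoint here)

⊆-≢-witness : ∀ {p q : Subset n} → p ⊆ q → p ≢ q → ∃ λ x → x ∈ q × x ∉ p
⊆-≢-witness {p = []}          {[]}          _   p≢q = contradiction refl p≢q
⊆-≢-witness {p = inside ∷ p}  {outside ∷ q} p⊆q _   = contradiction (p⊆q here) λ ()
⊆-≢-witness {p = outside ∷ p} {inside ∷ q}  _   _   = zero , here , λ ()
⊆-≢-witness {p = inside ∷ p}  {inside ∷ q}  p⊆q p≢q
  with ⊆-≢-witness (drop-∷-⊆ p⊆q) (p≢q ∘ cong (inside ∷_))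
... | x , x∈q , x∉p = suc x , there x∈q , x∉p ∘ drop-there
⊆-≢-witness {p = outside ∷ p} {outside ∷ q} p⊆q p≢q
  with ⊆-≢-witness (drop-∷-⊆ p⊆q) (p≢q ∘ cong (outside ∷_))
... | x , x∈q , x∉p = suc x , there x∈q , x∉p ∘ drop-there

data _⋖_ : Subset n → Subset n → Set where
  here  : ∀ {p q : Subset n} → (inside ∷ p) ⋖ (outside ∷ q)
  there : ∀ {s} {p q : Subset n} → p ⋖ q → (s ∷ p) ⋖ (s ∷ q)

⋖-─ : ∀ {p q : Subset n} {x} → x ∈ p → x ∈ q → p ⋖ (p ─ q)
⋖-─ here here = here
⋖-─ {p = inside ∷ p}  {inside ∷ q}  (there _)   (there _)   = here
⋖-─ {p = outside ∷ p} {inside ∷ q}  (there x∈p) (there x∈q) = there (⋖-─ x∈p x∈q)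
⋖-─ {p = _ ∷ p}       {outside ∷ q} (there x∈p) (there x∈q) = there (⋖-─ x∈p x∈q)

dshift-⊇pair : ∀ {i j} (𝒮 : Family n) {S} → i ∈ S → j ∈ S →
               dshift i j 𝒮 S ≡ 𝒮 S ∧ 𝒮 (S ─ pair i j)
dshift-⊇pair 𝒮 i∈S j∈S
  rewrite []=⇒lookup i∈S | []=⇒lookup j∈S = refl

dshift-gain : ∀ {i j} → i ≢ j → (𝒮 : Family n) (T : Subset n) →
  T ∈F dshift i j 𝒮 → 𝒮 T ≡ false →
  ∃ λ S → i ∈ S × j ∈ S × S ─ pair i j ≡ T × S ∈F 𝒮 × dshift i j 𝒮 S ≡ false
dshift-gain {i = i} {j} i≢j 𝒮 T gained lost
  with lookup T i in T[i] | lookup T j in T[j]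
... | true  | true  = contradiction (trans (sym (cong (_∧ 𝒮 (T ─ pair i j)) lost)) gained) λ ()
... | true  | false = contradiction (trans (sym gained) lost) λ ()
... | false | true  = contradiction (trans (sym gained) lost) λ ()
... | false | false = S , i∈S , j∈S , S─pair≡T , S∈𝒮 , S-removed
  where
  S = T ∪ pair i j
  i∈S : i ∈ S
  i∈S = x∈p∪q⁺ (inj₂ (x∈p∪q⁺ (inj₁ (x∈⁅x⁆ i))))
  j∈S : j ∈ S
  j∈S = x∈p∪q⁺ (inj₂ (x∈p∪q⁺ (inj₂ (x∈⁅x⁆ j))))
  pair-disjoint : ∀ {x} → x ∈ pair i j → x ∉ T
  pair-disjoint x∈pair with x∈p∪q⁻ ⁅ i ⁆ ⁅ j ⁆ x∈pair
  ... | inj₁ x∈⁅i⁆ rewrite x∈⁅y⁆⇒x≡y i x∈⁅i⁆ = lookup-false⇒∉ T[i]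
  ... | inj₂ x∈⁅j⁆ rewrite x∈⁅y⁆⇒x≡y j x∈⁅j⁆ = lookup-false⇒∉ T[j]
  S─pair≡T : S ─ pair i j ≡ T
  S─pair≡T = ∪─-cancel T (pair i j) pair-disjoint
  S∈𝒮 : S ∈F 𝒮
  S∈𝒮 = trans (sym (cong (_∨ 𝒮 S) lost)) gained
  S-removed : dshift i j 𝒮 S ≡ false
  S-removed = begin
    dshift i j 𝒮 S            ≡⟨ dshift-⊇pair 𝒮 i∈S j∈S ⟩
    𝒮 S ∧ 𝒮 (S ─ pair i j)    ≡⟨ cong (λ U → 𝒮 S ∧ 𝒮 U) S─pair≡T ⟩
    𝒮 S ∧ 𝒮 T                 ≡⟨ cong₂ _∧_ S∈𝒮 lost ⟩
    false                     ∎

-- d-shiftings preserve evenness: a gained set is two smaller than a member.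
even-dshift : ∀ {i j} → i ≢ j → (𝒮 : Family n) → EvenFamily 𝒮 → EvenFamily (dshift i j 𝒮)
even-dshift i≢j 𝒮 even T T∈ with 𝒮 T in T∈𝒮
... | true  = even T T∈𝒮
... | false with dshift-gain i≢j 𝒮 T T∈ T∈𝒮
...   | S , i∈S , j∈S , S─pair≡T , S∈𝒮 , _ = ∣m+n∣m⇒∣n 2∣2+∣T∣ ∣-refl
  where
  2∣2+∣T∣ : 2 ∣ 2 + ∣ T ∣
  2∣2+∣T∣ = subst (2 ∣_) (trans (∣p∣≡2+∣p─pair∣ i≢j i∈S j∈S)
                                (cong (λ U → 2 + ∣ U ∣) S─pair≡T))
                  (even S S∈𝒮)

_≐_ : Family n → Family n → Set
𝒜 ≐ ℬ = ∀ S → 𝒜 S ≡ ℬ S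

≐-trans : {𝒜 ℬ 𝒞 : Family n} → 𝒜 ≐ ℬ → ℬ ≐ 𝒞 → 𝒜 ≐ 𝒞
≐-trans 𝒜≐ℬ ℬ≐𝒞 S = trans (𝒜≐ℬ S) (ℬ≐𝒞 S)

upper lower : Family (suc n) → Family n
upper 𝒜 U = 𝒜 (inside ∷ U)
lower 𝒜 U = 𝒜 (outside ∷ U)

split : Family (suc n) → Family n × Family n
split 𝒜 = upper 𝒜 , lower 𝒜

-- 𝒜 ≺ ℬ: the first set (in the order ⋖) at which the two families differ
-- belongs to ℬ only; defined recursively through the splitting.
_≺_ : Family n → Family n → Set
_≺_ {zero}  𝒜 ℬ = 𝒜 [] ≡ false × ℬ [] ≡ true
_≺_ {suc n} = ×-Lex _≐_ _≺_ _≺_ on split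

≺-respʳ-≐ : ∀ {𝒜 ℬ 𝒞 : Family n} → ℬ ≐ 𝒞 → 𝒜 ≺ ℬ → 𝒜 ≺ 𝒞
≺-respʳ-≐ {zero}  ℬ≐𝒞 (𝒜[]≡false , ℬ[]≡true) = 𝒜[]≡false , trans (sym (ℬ≐𝒞 [])) ℬ[]≡true
≺-respʳ-≐ {suc n} ℬ≐𝒞 (inj₁ upper≺) = inj₁ (≺-respʳ-≐ (ℬ≐𝒞 ∘ (inside ∷_)) upper≺)
≺-respʳ-≐ {suc n} ℬ≐𝒞 (inj₂ (upper≐ , lower≺)) =
  inj₂ (≐-trans upper≐ (ℬ≐𝒞 ∘ (inside ∷_)) , ≺-respʳ-≐ (ℬ≐𝒞 ∘ (outside ∷_)) lower≺)

≺-wellFounded : WellFounded (_≺_ {n})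
≺-wellFounded {zero} 𝒜 = acc λ (ℬ[]≡false , _) →
  acc λ (_ , ℬ[]≡true) → contradiction (trans (sym ℬ[]≡false) ℬ[]≡true) λ ()
≺-wellFounded {suc n} = On.wellFounded split
  (×-wellFounded' ≐-trans ≺-respʳ-≐ ≺-wellFounded ≺-wellFounded)

Compensated : Family n → Family n → Set
Compensated {n} 𝒜 ℬ = ∀ T → T ∈F 𝒜 → ℬ T ≡ false →
  ∃ λ (U : Subset n) → U ⋖ T × U ∈F ℬ × 𝒜 U ≡ false

-- Compensation passes to the upper parts of the splitting: a set with
-- zero can only be paid for by an earlier set, which also contains zero.
upper-compensated : ∀ {𝒜 ℬ : Family (suc n)} → Compensated 𝒜 ℬ →
                    Compensated (upper 𝒜) (upper ℬ)
upper-compensated comp T gained lost with comp (inside ∷ T) gained lost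
... | _ ∷ U , there U⋖T , U∈ℬ , U∉𝒜 = U , U⋖T , U∈ℬ , U∉𝒜

-- With equal upper parts no set containing zero can pay for a gain, so
-- compensation passes to the lower parts.
lower-compensated : ∀ {𝒜 ℬ : Family (suc n)} → Compensated 𝒜 ℬ →
                    upper 𝒜 ≐ upper ℬ → Compensated (lower 𝒜) (lower ℬ)
lower-compensated comp upper≐ T gained lost with comp (outside ∷ T) gained lost
... | _ ∷ U , there U⋖T , U∈ℬ , U∉𝒜 = U , U⋖T , U∈ℬ , U∉𝒜
... | _ ∷ U , here , U∈ℬ , U∉𝒜 =
  contradiction (trans (sym U∉𝒜) (trans (upper≐ U) U∈ℬ)) λ ()

compensated⇒≼ : ∀ {𝒜 ℬ : Family n} → Compensated 𝒜 ℬ → 𝒜 ≐ ℬ ⊎ 𝒜 ≺ ℬ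
compensated⇒≼ {zero} {𝒜} {ℬ} comp with 𝒜 [] in 𝒜[] | ℬ [] in ℬ[]
... | true  | true  = inj₁ λ { [] → trans 𝒜[] (sym ℬ[]) }
... | false | false = inj₁ λ { [] → trans 𝒜[] (sym ℬ[]) }
... | false | true  = inj₂ (refl , refl)
... | true  | false with comp [] 𝒜[] ℬ[]
...   | _ , () , _
compensated⇒≼ {suc n} comp with compensated⇒≼ (upper-compensated comp)
... | inj₂ upper≺ = inj₂ (inj₁ upper≺)
... | inj₁ upper≐ with compensated⇒≼ (lower-compensated comp upper≐)
...   | inj₂ lower≺ = inj₂ (inj₂ (upper≐ , lower≺))
...   | inj₁ lower≐ = inj₁ λ { (inside ∷ U) → upper≐ U ; (outside ∷ U) → lower≐ U }

dshift-≼ : ∀ {i j} → i ≢ j → (𝒮 : Family n) → dshift i j 𝒮 ≐ 𝒮 ⊎ dshift i j 𝒮 ≺ 𝒮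
dshift-≼ {i = i} {j} i≢j 𝒮 = compensated⇒≼ compensated
  where
  compensated : Compensated (dshift i j 𝒮) 𝒮
  compensated T gained lost with dshift-gain i≢j 𝒮 T gained lost
  ... | S , i∈S , _ , S─pair≡T , S∈𝒮 , S-removed =
    S , subst (S ⋖_) S─pair≡T (⋖-─ i∈S (x∈p∪q⁺ (inj₁ (x∈⁅x⁆ i)))) , S∈𝒮 , S-removed

Closed : Family n → Set
Closed {n} 𝒞 = ∀ (S : Subset n) {i j} → i ≢ j → i ∈ S → j ∈ S →
  S ∈F 𝒞 → (S ─ pair i j) ∈F 𝒞

closed-tail : ∀ s {𝒞 : Family (suc n)} → Closed 𝒞 → Closed (λ U → 𝒞 (s ∷ U))
closed-tail s closed S i≢j i∈S j∈S =
  closed (s ∷ S) (i≢j ∘ suc-injective) (there i∈S) (there j∈S)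

parity-suc-injective : ∀ {m k} → parity (suc m) ≡ parity (suc k) → parity m ≡ parity k
parity-suc-injective {m} {k} eq = begin
  parity m              ≡⟨ suc-homo-⁻¹ m ⟨
  parity (suc m) ⁻¹     ≡⟨ cong _⁻¹ eq ⟩
  parity (suc k) ⁻¹     ≡⟨ suc-homo-⁻¹ k ⟩
  parity k              ∎

parity-suc-≢ : ∀ m → parity m ≢ parity (suc m)
parity-suc-≢ m eq = p≢p⁻¹ (parity (suc m)) (sym (trans (suc-homo-⁻¹ m) eq))

even⇒parity0 : ∀ {k} → 2 ∣ k → parity k ≡ 0ℙ
even⇒parity0 (divides q refl) = go q
  where
  go : ∀ q → parity (q * 2) ≡ 0ℙ
  go zero    = refl
  go (suc q) = go q

-- In a closed family, every subset of a member with the same parity of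
-- cardinality is a member; proved by induction on the ground set, deleting
-- the first element together with an element outside the subset when needed.
closed-down : ∀ {𝒞 : Family n} → Closed 𝒞 → ∀ {S T} → S ∈F 𝒞 → T ⊆ S →
              parity ∣ T ∣ ≡ parity ∣ S ∣ → T ∈F 𝒞
closed-down {zero} _ {[]} {[]} S∈𝒞 _ _ = S∈𝒞
closed-down {suc n} closed {outside ∷ S} {outside ∷ T} S∈𝒞 T⊆S same =
  closed-down (closed-tail outside closed) S∈𝒞 (drop-∷-⊆ T⊆S) same
closed-down {suc n} closed {inside ∷ S} {inside ∷ T} S∈𝒞 T⊆S same =
  closed-down (closed-tail inside closed) S∈𝒞 (drop-∷-⊆ T⊆S)
    (parity-suc-injective {∣ T ∣} {∣ S ∣} same)
closed-down {suc n} closed {outside ∷ S} {inside ∷ T} S∈𝒞 T⊆S same =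
  contradiction (T⊆S here) λ ()
closed-down {suc n} {𝒞} closed {inside ∷ S} {outside ∷ T} S∈𝒞 T⊆S same
  with ⊆-≢-witness (drop-∷-⊆ T⊆S) (λ T≡S →
      parity-suc-≢ ∣ S ∣ (trans (cong (parity ∘ ∣_∣) (sym T≡S)) same))
... | j , j∈S , j∉T =
  closed-down (closed-tail outside closed) S─j∈𝒞 T⊆S─j
    (trans same (cong (parity ∘ suc) (∣p∣≡1+∣p─⁅x⁆∣ j∈S)))
  where
  S─j∈𝒞 : (outside ∷ (S ─ ⁅ j ⁆)) ∈F 𝒞
  S─j∈𝒞 = subst (λ Q → (outside ∷ (S ─ Q)) ∈F 𝒞) (∪-identityˡ ⁅ j ⁆)
            (closed (inside ∷ S) {zero} {suc j} (λ ()) here (there j∈S) S∈𝒞)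
  T⊆S─j : T ⊆ S ─ ⁅ j ⁆
  T⊆S─j {x} x∈T = x∈p∧x∉q⇒x∈p─q (drop-∷-⊆ T⊆S x∈T)
    λ x∈⁅j⁆ → j∉T (subst (_∈ T) (x∈⁅y⁆⇒x≡y j x∈⁅j⁆) x∈T)

closed⇒bouquet : ∀ {𝒞 : Family n} → Closed 𝒞 → EvenFamily 𝒞 → BouquetOfHalvedCubes 𝒞
closed⇒bouquet closed even = even , λ S T S∈𝒞 T⊆S T-even →
  closed-down closed S∈𝒞 T⊆S
    (trans (even⇒parity0 T-even) (sym (even⇒parity0 (even S S∈𝒞))))

stable⇒closed : ∀ {𝒮 : Family n} → (∀ {i j} → i ≢ j → dshift i j 𝒮 ≐ 𝒮) → Closed 𝒮
stable⇒closed {𝒮 = 𝒮} stable S {i} {j} i≢j i∈S j∈S S∈𝒮 = begin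
  𝒮 (S ─ pair i j)          ≡⟨ cong (_∧ 𝒮 (S ─ pair i j)) S∈𝒮 ⟨
  𝒮 S ∧ 𝒮 (S ─ pair i j)    ≡⟨ dshift-⊇pair 𝒮 i∈S j∈S ⟨
  dshift i j 𝒮 S            ≡⟨ stable i≢j S ⟩
  𝒮 S                       ≡⟨ S∈𝒮 ⟩
  true                      ∎

all-or-witness : ∀ {P Q : Fin n → Set} → (∀ i → P i ⊎ Q i) → (∀ i → P i) ⊎ ∃ Q
all-or-witness {zero}  _ = inj₁ λ ()
all-or-witness {suc n} dec with dec zero | all-or-witness (dec ∘ suc)
... | inj₂ q₀ | _              = inj₂ (zero , q₀)
... | inj₁ _  | inj₂ (i , qᵢ)  = inj₂ (suc i , qᵢ)
... | inj₁ p₀ | inj₁ ps        = inj₁ λ { zero → p₀ ; (suc i) → ps i }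

dshift-outcome : ∀ (𝒮 : Family n) i j →
  (i ≢ j → dshift i j 𝒮 ≐ 𝒮) ⊎ (i ≢ j × dshift i j 𝒮 ≺ 𝒮)
dshift-outcome 𝒮 i j with i ≟ j
... | yes i≡j = inj₁ λ i≢j → contradiction i≡j i≢j
... | no  i≢j with dshift-≼ i≢j 𝒮
...   | inj₁ fixed     = inj₁ λ _ → fixed
...   | inj₂ decreased = inj₂ (i≢j , decreased)

shift-to-bouquet : (𝒮 : Family n) → Acc _≺_ 𝒮 → EvenFamily 𝒮 →
  Σ (List (TwoSet n)) λ ps → BouquetOfHalvedCubes (dshifts ps 𝒮)
shift-to-bouquet 𝒮 (acc smaller) even
  with all-or-witness (λ i → all-or-witness (dshift-outcome 𝒮 i))
... | inj₁ stable = [] , closed⇒bouquet (stable⇒closed λ {i} {j} → stable i j) even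
... | inj₂ (i , j , i≢j , decreased)
  with shift-to-bouquet (dshift i j 𝒮) (smaller decreased) (even-dshift i≢j 𝒮 even)
...   | ps , bouquet = (i , j , i≢j) ∷ ps , bouquet

lemma7 : (n : ℕ) (𝒮 : Family n) → Pointed 𝒮 → EvenFamily 𝒮 →
    Σ (List (TwoSet n)) λ ps → BouquetOfHalvedCubes (dshifts ps 𝒮)
lemma7 n 𝒮 _ even = shift-to-bouquet 𝒮 (≺-wellFounded 𝒮) even
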